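{- Let $\gamma>0$, let $m\geq 1$ be an integer, and let $\mathcal H=(V,E)$ be a $3$-uniform hypergraph on $n$ vertices with $\delta_1(\mathcal H)\geq\left(\frac14+\gamma\right)\binom{n}{2}$ and $m\leq \gamma n/12$. Then for every family $(a_i,b_i)_{i\in[m]}$ of mutually disjoint pairs of distinct vertices of $V$ there exists a family of triples $(x_i,y_i,z_i)_{i\in[m]}$ of vertices connecting $(a_i,b_i)_{i\in[m]}$.
   Context: $\delta_1(\mathcal H)$ denotes the minimum, over all vertices $v$, of the number of edges of $\mathcal H$ containing $v$. A family of triples $(x_i,y_i,z_i)_{i\in[k]}$ connects the family of pairs $(a_i,b_i)_{i\in[k]}$ if $\big|\bigcup_{i\in[k]}\{a_i,b_i,x_i,y_i,z_i\}\big|=5k$ (i.e. all these vertices are distinct) and for all $i\in[k]$ both $\{a_i,x_i,y_i\}$ and $\{y_i,z_i,b_i\}$ are edges of $\mathcal H$.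
   Formalization: The parameter γ ranges over the positive rationals. -}

module Defs where

open import Data.Nat using (ℕ; _+_; _<ᵇ_)
open import Data.Bool using (Bool; true; false; if_then_else_; _∧_)
open import Data.Fin using (Fin; toℕ)
open import Data.List using (List; []; _∷_; map; allFin; concatMap)
open import Data.Nat.ListAction using (sum)
open import Data.List.Relation.Unary.Unique.Propositional using (Unique)
open import Data.Product using (_×_)
open import Relation.Binary.PropositionalEquality using (_≡_)

-- The predicate is invariant
-- under permutations and false on any triple with a repeated vertex, so it
-- encodes exactly a set of 3-element subsets of Fin n.
record Hypergraph3 (n : ℕ) : Set where
  field
    edge     : Fin n → Fin n → Fin n → Bool
    sym₁₂    : ∀ x y z → edge x y z ≡ edge y x z
    sym₂₃    : ∀ x y z → edge x y z ≡ edge x z y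
    loopless : ∀ x y → edge x x y ≡ false

open Hypergraph3 public

count : ∀ {n} → (Fin n → Bool) → ℕ
count {n} p = sum (map (λ u → if p u then 1 else 0) (allFin n))

-- degree of v: number of edges containing v, i.e. number of unordered
-- pairs {u,w} (counted once via toℕ u < toℕ w) with {v,u,w} an edge.
degree : ∀ {n} → Hypergraph3 n → Fin n → ℕ
degree {n} H v = sum (map (λ u → count (λ w → (toℕ u <ᵇ toℕ w) ∧ edge H v u w)) (allFin n))

pairVertices : ∀ {n m} → (Fin m → Fin n) → (Fin m → Fin n) → List (Fin n)
pairVertices {m = m} a b = concatMap (λ i → a i ∷ b i ∷ []) (allFin m)

allVertices : ∀ {n m} → (a b x y z : Fin m → Fin n) → List (Fin n)
allVertices {m = m} a b x y z =
  concatMap (λ i → a i ∷ b i ∷ x i ∷ y i ∷ z i ∷ []) (allFin m)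

Connects : ∀ {n m} → Hypergraph3 n → (a b x y z : Fin m → Fin n) → Set
Connects {m = m} H a b x y z =
  Unique (allVertices a b x y z) ×
  (∀ (i : Fin m) → (edge H (a i) (x i) (y i) ≡ true) × (edge H (y i) (z i) (b i) ≡ true))

module Submission where

-- The pairs are connected greedily, each through three vertices not used before, so at every step at
-- most 5m vertices are forbidden.  For the current pair (a, b) consider the links of a and of b restricted
-- to the allowed vertices.  A vertex y with a link-neighbour x of a and a link-neighbour z ≠ x of b gives
-- the path a x y z b.  If there is no such y, a vertex lying in both links has degree at most 1 in each.
-- With p, q, i the numbers of vertices only in the link of a, only in that of b, and in both, the link of a
-- then has at most p(p + i) + i ordered pairs, that of b at most q(q + i) + i, and p + q + i ≤ n.  The
-- forbidden vertices meet at most 10nm ordered pairs of a full link, so for the endpoint c on the side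
-- s = min(p, q) we get 8 deg c ≤ 4(s(s + i) + i) + 40nm ≤ (2s + i)² + 4 + 40nm ≤ n² + 4 + 40nm.
-- Eliminating γ with 12m ≤ γn, the degree hypothesis reads (n + 48m)(n − 1) ≤ 8 deg c; together with
-- 2 deg c ≤ n(n − 1) it forces 16m ≤ n, and then the two bounds on deg c are incompatible.

open import Defs
open import Data.Bool using (Bool; true; false; not; _∧_; _∨_; if_then_else_)
open import Data.Bool.Properties using (∧-comm; ∧-zeroʳ; ∧-conicalˡ; ∧-conicalʳ; T-≡)
open import Data.Empty using (⊥; ⊥-elim)
open import Data.Fin using (Fin; zero; suc; toℕ)
open import Data.Fin.Properties using (_≟_; toℕ-injective; any?)
open import Data.Integer as ℤ using (ℤ; +_)
import Data.Integer.Properties as ℤ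
import Data.Integer.Tactic.RingSolver as ℤ-Solver
open import Data.List using (List; []; _∷_; _++_; length; map; concat; concatMap; allFin; tabulate)
open import Data.List.Properties using (map-tabulate; ++-assoc; length-++)
open import Data.List.Membership.Propositional using (_∉_)
open import Data.List.Relation.Binary.Permutation.Propositional using (↭⇒↭ₛ)
open import Data.List.Relation.Binary.Permutation.Propositional.Properties using (shifts)
import Data.List.Relation.Binary.Permutation.Setoid.Properties as Permutationₛ
open import Data.List.Relation.Unary.All as All using (All; []; _∷_)
open import Data.List.Relation.Unary.Unique.Propositional using (Unique; []; _∷_)
import Data.List.Relation.Unary.Unique.Propositional.Properties as Unique
open import Data.Nat
  using (ℕ; zero; suc; _+_; _*_; _∸_; _≤_; _<_; _≥_; _<ᵇ_; _≤?_; z≤n; s≤s; NonZero; >-nonZero)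
open import Data.Nat.Combinatorics using (_C_; nC1≡n; nCk+nC[k+1]≡[n+1]C[k+1])
import Data.Nat.ListAction as List
open import Data.Nat.Properties hiding (_≟_)
open import Algebra.Properties.Semiring.Sum +-*-semiring
  using (sum-syntax; ∑-distrib-+; ∑-comm; sum-cong-≗; *-distribˡ-sum; *-distribʳ-sum)
open import Data.Nat.Tactic.RingSolver using (solve-∀)
open import Data.Product using (Σ; ∃-syntax; _×_; _,_)
open import Data.Rational as ℚ using (ℚ; mkℚ; _/_; toℚᵘ)
import Data.Rational.Properties as ℚ
import Data.Rational.Unnormalised as ℚᵘ
import Data.Rational.Unnormalised.Properties as ℚᵘ
open import Data.Sum using (_⊎_; inj₁; inj₂; [_,_]′)
import Data.Vec.Functional as Vector
open import Function using (_∘_; case_of_)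
open import Function.Bundles using (Equivalence)
open import Relation.Binary.PropositionalEquality
open import Relation.Nullary using (¬_; Dec; yes; no; does)
open import Relation.Nullary.Decidable using (_×-dec_; _⊎-dec_)
open import Relation.Nullary.Reflects using (ofʸ; ofⁿ)

-- Finite sums and counting

𝟙 : Bool → ℕ
𝟙 b = if b then 1 else 0

𝟙≤1 : ∀ b → 𝟙 b ≤ 1
𝟙≤1 true  = ≤-refl
𝟙≤1 false = z≤n

∑-mono-≤ : ∀ {n} {f g : Fin n → ℕ} → (∀ i → f i ≤ g i) → ∑[ i < n ] f i ≤ ∑[ i < n ] g i
∑-mono-≤ {zero}  f≤g = z≤n
∑-mono-≤ {suc n} f≤g = +-mono-≤ (f≤g zero) (∑-mono-≤ (f≤g ∘ suc))

∑-const : ∀ n c → ∑[ i < n ] c ≡ n * c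
∑-const zero    c = refl
∑-const (suc n) c = cong (_+_ c) (∑-const n c)

≤-∑ : ∀ {n} (f : Fin n → ℕ) i → f i ≤ ∑[ j < n ] f j
≤-∑ f zero    = m≤m+n _ _
≤-∑ f (suc i) = ≤-trans (≤-∑ (f ∘ suc) i) (m≤n+m _ (f zero))

∑>0⇒∃ : ∀ {n} (f : Fin n → ℕ) → 0 < ∑[ i < n ] f i → ∃[ i ] 0 < f i
∑>0⇒∃ {suc n} f ∑>0 with f zero in eq
... | suc _ = zero , subst (0 <_) (sym eq) (s≤s z≤n)
... | zero  with ∑>0⇒∃ (f ∘ suc) ∑>0
...   | i , fi>0 = suc i , fi>0

sum-allFin : ∀ {n} (f : Fin n → ℕ) → List.sum (map f (allFin n)) ≡ ∑[ i < n ] f i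
sum-allFin {n} f = trans (cong List.sum (map-tabulate (λ i → i) f)) (sum-tabulate f)
  where
  sum-tabulate : ∀ {k} (g : Fin k → ℕ) → List.sum (tabulate g) ≡ ∑[ i < k ] g i
  sum-tabulate {zero}  g = refl
  sum-tabulate {suc k} g = cong (_+_ (g zero)) (sum-tabulate (g ∘ suc))

module _ {n : ℕ} where

  count-∑ : (p : Fin n → Bool) → count p ≡ ∑[ u < n ] 𝟙 (p u)
  count-∑ p = sum-allFin (𝟙 ∘ p)

  count-cong : {p q : Fin n → Bool} → (∀ u → p u ≡ q u) → count p ≡ count q
  count-cong {p} {q} p≗q = trans (count-∑ p) (trans (sum-cong-≗ (cong 𝟙 ∘ p≗q)) (sym (count-∑ q)))

  count-mono : {p q : Fin n → Bool} → (∀ u → p u ≡ true → q u ≡ true) → count p ≤ count q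
  count-mono {p} {q} p⇒q = begin
    count p             ≡⟨ count-∑ p ⟩
    ∑[ u < n ] 𝟙 (p u)  ≤⟨ ∑-mono-≤ pointwise ⟩
    ∑[ u < n ] 𝟙 (q u)  ≡⟨ count-∑ q ⟨
    count q             ∎
    where
    open ≤-Reasoning
    pointwise : ∀ u → 𝟙 (p u) ≤ 𝟙 (q u)
    pointwise u with p u in pu
    ... | false = z≤n
    ... | true  rewrite p⇒q u pu = ≤-refl

  count-split : (p q : Fin n → Bool) →
                count p ≡ count (λ u → p u ∧ not (q u)) + count (λ u → p u ∧ q u)
  count-split p q = begin
    count p
      ≡⟨ count-∑ p ⟩
    ∑[ u < n ] 𝟙 (p u)
      ≡⟨ sum-cong-≗ pointwise ⟩
    ∑[ u < n ] (𝟙 (p u ∧ not (q u)) + 𝟙 (p u ∧ q u))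
      ≡⟨ ∑-distrib-+ (λ u → 𝟙 (p u ∧ not (q u))) (λ u → 𝟙 (p u ∧ q u)) ⟩
    ∑[ u < n ] 𝟙 (p u ∧ not (q u)) + ∑[ u < n ] 𝟙 (p u ∧ q u)
      ≡⟨ cong₂ _+_ (count-∑ (λ u → p u ∧ not (q u))) (count-∑ (λ u → p u ∧ q u)) ⟨
    count (λ u → p u ∧ not (q u)) + count (λ u → p u ∧ q u) ∎
    where
    open ≡-Reasoning
    pointwise : ∀ u → 𝟙 (p u) ≡ 𝟙 (p u ∧ not (q u)) + 𝟙 (p u ∧ q u)
    pointwise u with p u | q u
    ... | false | _     = refl
    ... | true  | false = refl
    ... | true  | true  = refl

  count-all : count {n} (λ _ → true) ≡ n
  count-all = trans (count-∑ _) (trans (∑-const n 1) (*-identityʳ n))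

  count-disjoint : {p q : Fin n → Bool} → (∀ u → p u ∧ q u ≡ false) → count p + count q ≤ n
  count-disjoint {p} {q} disjoint = begin
    count p + count q                       ≡⟨ cong₂ _+_ (count-∑ p) (count-∑ q) ⟩
    ∑[ u < n ] 𝟙 (p u) + ∑[ u < n ] 𝟙 (q u) ≡⟨ ∑-distrib-+ (𝟙 ∘ p) (𝟙 ∘ q) ⟨
    ∑[ u < n ] (𝟙 (p u) + 𝟙 (q u))          ≤⟨ ∑-mono-≤ pointwise ⟩
    ∑[ u < n ] 1                            ≡⟨ ∑-const n 1 ⟩
    n * 1                                   ≡⟨ *-identityʳ n ⟩
    n                                       ∎
    where
    open ≤-Reasoning
    pointwise : ∀ u → 𝟙 (p u) + 𝟙 (q u) ≤ 1
    pointwise u with p u | q u | disjoint u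
    ... | false | b     | _ = 𝟙≤1 b
    ... | true  | false | _ = ≤-refl

  count-∨ : (p q : Fin n → Bool) → count (λ u → p u ∨ q u) ≤ count p + count q
  count-∨ p q = begin
    count (λ u → p u ∨ q u)                 ≡⟨ count-∑ (λ u → p u ∨ q u) ⟩
    ∑[ u < n ] 𝟙 (p u ∨ q u)                ≤⟨ ∑-mono-≤ pointwise ⟩
    ∑[ u < n ] (𝟙 (p u) + 𝟙 (q u))          ≡⟨ ∑-distrib-+ (𝟙 ∘ p) (𝟙 ∘ q) ⟩
    ∑[ u < n ] 𝟙 (p u) + ∑[ u < n ] 𝟙 (q u) ≡⟨ cong₂ _+_ (count-∑ p) (count-∑ q) ⟨
    count p + count q                       ∎
    where
    open ≤-Reasoning
    pointwise : ∀ u → 𝟙 (p u ∨ q u) ≤ 𝟙 (p u) + 𝟙 (q u)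
    pointwise u with p u | q u
    ... | false | b = ≤-refl
    ... | true  | b = s≤s z≤n

  ∃⇒count>0 : (p : Fin n → Bool) {u : Fin n} → p u ≡ true → 0 < count p
  ∃⇒count>0 p {u} pu = begin-strict
    0                  <⟨ subst (λ b → 0 < 𝟙 b) (sym pu) (s≤s z≤n) ⟩
    𝟙 (p u)            ≤⟨ ≤-∑ (𝟙 ∘ p) u ⟩
    ∑[ v < n ] 𝟙 (p v) ≡⟨ count-∑ p ⟨
    count p            ∎
    where open ≤-Reasoning

  count>0⇒∃ : (p : Fin n → Bool) → 0 < count p → ∃[ u ] p u ≡ true
  count>0⇒∃ p count>0 with ∑>0⇒∃ (𝟙 ∘ p) (subst (0 <_) (count-∑ p) count>0)
  ... | u , 𝟙pu>0 = u , 𝟙>0⇒true (p u) 𝟙pu>0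
    where
    𝟙>0⇒true : ∀ b → 0 < 𝟙 b → b ≡ true
    𝟙>0⇒true true _ = refl

  count-< : (p : Fin n → Bool) {u : Fin n} → p u ≡ false → count p < n
  count-< p pu = begin-strict
    count p                            <⟨ m<n+m (count p) (∃⇒count>0 (not ∘ p) (cong not pu)) ⟩
    count (λ u → not (p u)) + count p  ≡⟨ count-split (λ _ → true) p ⟨
    count {n} (λ _ → true)             ≡⟨ count-all ⟩
    n                                  ∎
    where open ≤-Reasoning

  count-≟ : (w : Fin n) → count (λ u → does (u ≟ w)) ≡ 1
  count-≟ w = trans (count-∑ _) (∑-≟ w)
    where
    ∑-≟ : ∀ {k} (w : Fin k) → ∑[ u < k ] 𝟙 (does (u ≟ w)) ≡ 1
    ∑-≟ {suc k} zero    = cong suc (trans (∑-const k 0) (*-zeroʳ k))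
    ∑-≟ {suc k} (suc w) = ∑-≟ w

  count≥2⇒∃≢ : (p : Fin n → Bool) → 2 ≤ count p → (w : Fin n) → ∃[ u ] u ≢ w × p u ≡ true
  count≥2⇒∃≢ p count≥2 w = witness (count>0⇒∃ p∖w (≤-pred count[p∖w]≥1))
    where
    p∖w : Fin n → Bool
    p∖w u = p u ∧ not (does (u ≟ w))
    count[p∖w]≥1 : 2 ≤ 1 + count p∖w
    count[p∖w]≥1 = begin
      2                                             ≤⟨ count≥2 ⟩
      count p                                       ≡⟨ count-split p (λ u → does (u ≟ w)) ⟩
      count p∖w + count (λ u → p u ∧ does (u ≟ w))
        ≤⟨ +-monoʳ-≤ (count p∖w) (count-mono (λ u → ∧-conicalʳ (p u) _)) ⟩
      count p∖w + count (λ u → does (u ≟ w))        ≡⟨ cong (_+_ (count p∖w)) (count-≟ w) ⟩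
      count p∖w + 1                                 ≡⟨ +-comm (count p∖w) 1 ⟩
      1 + count p∖w                                 ∎
      where open ≤-Reasoning
    witness : ∃[ u ] p∖w u ≡ true → ∃[ u ] u ≢ w × p u ≡ true
    witness (u , p∖wu) = u , u≢w , ∧-conicalˡ (p u) _ p∖wu
      where
      u≢w : u ≢ w
      u≢w with u ≟ w | ∧-conicalʳ (p u) _ p∖wu
      ... | no u≢w | _ = u≢w

  open import Data.List.Membership.DecPropositional (_≟_ {n}) using (_∈?_)

  count-∈ : (xs : List (Fin n)) → count (λ v → does (v ∈? xs)) ≤ length xs
  count-∈ []       = ≤-reflexive (trans (count-∑ _) (trans (∑-const n 0) (*-zeroʳ n)))
  count-∈ (x ∷ xs) = begin
    count (λ v → does (v ≟ x) ∨ does (v ∈? xs))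
      ≤⟨ count-∨ _ _ ⟩
    count (λ v → does (v ≟ x)) + count (λ v → does (v ∈? xs))
      ≤⟨ +-mono-≤ (≤-reflexive (count-≟ x)) (count-∈ xs) ⟩
    1 + length xs ∎
    where open ≤-Reasoning

module _ {n : ℕ} where

  #pairs : (Fin n → Fin n → Bool) → ℕ
  #pairs R = ∑[ y < n ] count (R y)

  avoiding : (Fin n → Bool) → (Fin n → Fin n → Bool) → Fin n → Fin n → Bool
  avoiding U R y x = (not (U y) ∧ not (U x)) ∧ R y x

  #pairs-avoiding : ∀ U R → #pairs R ≤ #pairs (avoiding U R) + n * count U + n * count U
  #pairs-avoiding U R = begin
    ∑[ y < n ] count (R y)
      ≡⟨ sum-cong-≗ (λ y → count-∑ (R y)) ⟩
    ∑[ y < n ] ∑[ x < n ] 𝟙 (R y x)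
      ≤⟨ ∑-mono-≤ (λ y → ∑-mono-≤ (pointwise y)) ⟩
    ∑[ y < n ] ∑[ x < n ] (𝟙 (avoiding U R y x) + 𝟙 (U y) + 𝟙 (U x))
      ≡⟨ sum-cong-≗ sum-over-x ⟩
    ∑[ y < n ] (count (avoiding U R y) + n * 𝟙 (U y) + count U)
      ≡⟨ ∑-distrib-+ (λ y → count (avoiding U R y) + n * 𝟙 (U y)) (λ _ → count U) ⟩
    ∑[ y < n ] (count (avoiding U R y) + n * 𝟙 (U y)) + ∑[ y < n ] count U
      ≡⟨ cong₂ _+_ (∑-distrib-+ (λ y → count (avoiding U R y)) (λ y → n * 𝟙 (U y))) (∑-const n (count U)) ⟩
    #pairs (avoiding U R) + ∑[ y < n ] (n * 𝟙 (U y)) + n * count U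
      ≡⟨ cong (λ k → #pairs (avoiding U R) + k + n * count U)
              (trans (cong (n *_) (count-∑ U)) (*-distribˡ-sum n (𝟙 ∘ U))) ⟨
    #pairs (avoiding U R) + n * count U + n * count U ∎
    where
    open ≤-Reasoning
    pointwise : ∀ y x → 𝟙 (R y x) ≤ 𝟙 (avoiding U R y x) + 𝟙 (U y) + 𝟙 (U x)
    pointwise y x with U y | U x | R y x
    ... | false | false | r = ≤-trans (m≤m+n (𝟙 r) 0) (m≤m+n (𝟙 r + 0) 0)
    ... | false | true  | r = 𝟙≤1 r
    ... | true  | u     | r = ≤-trans (𝟙≤1 r) (m≤m+n 1 (𝟙 u))
    sum-over-x : ∀ y → ∑[ x < n ] (𝟙 (avoiding U R y x) + 𝟙 (U y) + 𝟙 (U x)) ≡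
                       count (avoiding U R y) + n * 𝟙 (U y) + count U
    sum-over-x y = trans (∑-distrib-+ (λ x → 𝟙 (avoiding U R y x) + 𝟙 (U y)) (𝟙 ∘ U))
      (cong₂ _+_ (trans (∑-distrib-+ (𝟙 ∘ avoiding U R y) (λ _ → 𝟙 (U y)))
                        (cong₂ _+_ (sym (count-∑ (avoiding U R y))) (∑-const n (𝟙 (U y)))))
                 (sym (count-∑ U)))

  module SymmetricRelation (R : Fin n → Fin n → Bool) (R-sym : ∀ x y → R x y ≡ R y x) where

    nonIsolated : Fin n → Bool
    nonIsolated y = 0 <ᵇ count (R y)

    nonIsolated⇒count>0 : ∀ {y} → nonIsolated y ≡ true → 0 < count (R y)
    nonIsolated⇒count>0 {y} = <ᵇ⇒< 0 (count (R y)) ∘ Equivalence.from T-≡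

    count≤#nonIsolated : ∀ y → count (R y) ≤ count nonIsolated
    count≤#nonIsolated y =
      count-mono (λ x Ryx → Equivalence.to T-≡ (<⇒<ᵇ (∃⇒count>0 (R x) (trans (R-sym x y) Ryx))))

    #pairs-bound : (B : Fin n → Bool) → (∀ y → B y ≡ true → count (R y) ≤ 1) →
      #pairs R ≤ count (λ y → nonIsolated y ∧ not (B y)) * count nonIsolated + count (λ y → nonIsolated y ∧ B y)
    #pairs-bound B B⇒≤1 = begin
      ∑[ y < n ] count (R y)
        ≤⟨ ∑-mono-≤ pointwise ⟩
      ∑[ y < n ] (𝟙 (nonIsolated y ∧ not (B y)) * count nonIsolated + 𝟙 (nonIsolated y ∧ B y))
        ≡⟨ ∑-distrib-+ (λ y → 𝟙 (nonIsolated y ∧ not (B y)) * count nonIsolated)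
                       (λ y → 𝟙 (nonIsolated y ∧ B y)) ⟩
      ∑[ y < n ] (𝟙 (nonIsolated y ∧ not (B y)) * count nonIsolated) + ∑[ y < n ] 𝟙 (nonIsolated y ∧ B y)
        ≡⟨ cong₂ _+_ (trans (sym (*-distribʳ-sum (count nonIsolated) (λ y → 𝟙 (nonIsolated y ∧ not (B y)))))
                            (cong (_* count nonIsolated) (sym (count-∑ (λ y → nonIsolated y ∧ not (B y))))))
                     (sym (count-∑ (λ y → nonIsolated y ∧ B y))) ⟩
      count (λ y → nonIsolated y ∧ not (B y)) * count nonIsolated + count (λ y → nonIsolated y ∧ B y) ∎
      where
      open ≤-Reasoning
      pointwise : ∀ y →
        count (R y) ≤ 𝟙 (nonIsolated y ∧ not (B y)) * count nonIsolated + 𝟙 (nonIsolated y ∧ B y)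
      pointwise y with 0 <ᵇ count (R y) | <ᵇ-reflects-< 0 (count (R y)) | B y in By
      ... | false | ofⁿ isolated | _     = ≤-trans (≮⇒≥ isolated) z≤n
      ... | true  | _            | true  = B⇒≤1 y By
      ... | true  | _            | false =
        subst (count (R y) ≤_) (sym (trans (+-identityʳ _) (*-identityˡ _))) (count≤#nonIsolated y)

𝟙-split-<ᵇ : ∀ i j e → (i ≡ j → e ≡ false) → 𝟙 ((i <ᵇ j) ∧ e) + 𝟙 ((j <ᵇ i) ∧ e) ≡ 𝟙 e
𝟙-split-<ᵇ i j e i≡j⇒¬e with i <ᵇ j | <ᵇ-reflects-< i j | j <ᵇ i | <ᵇ-reflects-< j i
... | true  | ofʸ i<j | true  | ofʸ j<i = ⊥-elim (<-asym i<j j<i)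
... | true  | _       | false | _       = +-identityʳ (𝟙 e)
... | false | _       | true  | _       = refl
... | false | ofⁿ i≮j | false | ofⁿ j≮i rewrite i≡j⇒¬e (≤-antisym (≮⇒≥ j≮i) (≮⇒≥ i≮j)) = refl

module _ {n : ℕ} (H : Hypergraph3 n) where

  edge-repeated : ∀ v u → edge H v u u ≡ false
  edge-repeated v u = trans (sym₁₂ H v u u) (trans (sym₂₃ H u v u) (loopless H u v))

  edge⇒≢₂₃ : ∀ {v x y} → edge H v x y ≡ true → x ≢ y
  edge⇒≢₂₃ {v} {x} e refl = case trans (sym e) (edge-repeated v x) of λ ()

  edge⇒≢₁₂ : ∀ {x y v} → edge H x y v ≡ true → x ≢ y
  edge⇒≢₁₂ {x} {v = v} e refl = case trans (sym e) (loopless H x v) of λ ()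

  degree-doubled : ∀ v → degree H v + degree H v ≡ #pairs (edge H v)
  degree-doubled v = begin
    degree H v + degree H v
      ≡⟨ cong₂ _+_ degree-∑ (trans degree-∑ mirror) ⟩
    ∑[ u < n ] ∑[ w < n ] 𝟙 (u<w u w) + ∑[ u < n ] ∑[ w < n ] 𝟙 (w<u u w)
      ≡⟨ ∑-distrib-+ (λ u → ∑[ w < n ] 𝟙 (u<w u w)) (λ u → ∑[ w < n ] 𝟙 (w<u u w)) ⟨
    ∑[ u < n ] (∑[ w < n ] 𝟙 (u<w u w) + ∑[ w < n ] 𝟙 (w<u u w))
      ≡⟨ sum-cong-≗ (λ u → ∑-distrib-+ (λ w → 𝟙 (u<w u w)) (λ w → 𝟙 (w<u u w))) ⟨
    ∑[ u < n ] ∑[ w < n ] (𝟙 (u<w u w) + 𝟙 (w<u u w))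
      ≡⟨ sum-cong-≗ (λ u → sum-cong-≗ (split u)) ⟩
    ∑[ u < n ] ∑[ w < n ] 𝟙 (edge H v u w)
      ≡⟨ sum-cong-≗ (λ u → count-∑ (edge H v u)) ⟨
    #pairs (edge H v) ∎
    where
    open ≡-Reasoning
    u<w w<u : Fin n → Fin n → Bool
    u<w u w = (toℕ u <ᵇ toℕ w) ∧ edge H v u w
    w<u u w = (toℕ w <ᵇ toℕ u) ∧ edge H v u w
    degree-∑ : degree H v ≡ ∑[ u < n ] ∑[ w < n ] 𝟙 (u<w u w)
    degree-∑ = trans (sum-allFin (λ u → count (u<w u))) (sum-cong-≗ (λ u → count-∑ (u<w u)))
    mirror : ∑[ u < n ] ∑[ w < n ] 𝟙 (u<w u w) ≡ ∑[ u < n ] ∑[ w < n ] 𝟙 (w<u u w)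
    mirror = trans (∑-comm (λ u w → 𝟙 (u<w u w)))
      (sum-cong-≗ (λ u → sum-cong-≗ (λ w → cong (λ b → 𝟙 ((toℕ w <ᵇ toℕ u) ∧ b)) (sym₂₃ H v w u))))
    split : ∀ u w → 𝟙 (u<w u w) + 𝟙 (w<u u w) ≡ 𝟙 (edge H v u w)
    split u w = 𝟙-split-<ᵇ (toℕ u) (toℕ w) (edge H v u w)
      (λ u≡w → subst (λ w → edge H v u w ≡ false) (toℕ-injective u≡w) (edge-repeated v u))

  degree-upper : ∀ v → degree H v + degree H v ≤ n * (n ∸ 1)
  degree-upper v = begin
    degree H v + degree H v  ≡⟨ degree-doubled v ⟩
    #pairs (edge H v)        ≤⟨ ∑-mono-≤ link<n ⟩
    ∑[ u < n ] (n ∸ 1)       ≡⟨ ∑-const n (n ∸ 1) ⟩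
    n * (n ∸ 1)              ∎
    where
    open ≤-Reasoning
    link<n : ∀ u → count (edge H v u) ≤ n ∸ 1
    link<n u = subst (count (edge H v u) ≤_) (pred[m∸n]≡m∸[1+n] n 0)
                     (<⇒≤pred (count-< (edge H v u) (edge-repeated v u)))

8d≡4[d+d] : ∀ d → 8 * d ≡ 4 * (d + d)
8d≡4[d+d] = solve-∀

k+k≤5k : ∀ k → k + k ≤ 5 * k
k+k≤5k k = subst (k + k ≤_) (collect k) (m≤m+n (k + k) (3 * k))
  where
  collect : ∀ k → k + k + 3 * k ≡ 5 * k
  collect = solve-∀

4i≤i²+4 : ∀ i → 4 * i ≤ i * i + 4
4i≤i²+4 0 = z≤n
4i≤i²+4 1 = s≤s (s≤s (s≤s (s≤s z≤n)))
4i≤i²+4 2 = ≤-refl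
4i≤i²+4 3 = m≤m+n 12 1
4i≤i²+4 i@(suc (suc (suc (suc _)))) =
  ≤-trans (*-monoˡ-≤ i {4} {i} (s≤s (s≤s (s≤s (s≤s z≤n))))) (m≤m+n (i * i) 4)

4[p[p+i]+i]≤[2p+i]²+4 : ∀ p i → 4 * (p * (p + i) + i) ≤ (p + p + i) * (p + p + i) + 4
4[p[p+i]+i]≤[2p+i]²+4 p i = begin
  4 * (p * (p + i) + i)            ≡⟨ expand p i ⟩
  4 * (p * (p + i)) + 4 * i        ≤⟨ +-monoʳ-≤ (4 * (p * (p + i))) (4i≤i²+4 i) ⟩
  4 * (p * (p + i)) + (i * i + 4)  ≡⟨ complete-square p i ⟩
  (p + p + i) * (p + p + i) + 4    ∎
  where
  open ≤-Reasoning
  expand : ∀ p i → 4 * (p * (p + i) + i) ≡ 4 * (p * (p + i)) + 4 * i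
  expand = solve-∀
  complete-square : ∀ p i → 4 * (p * (p + i)) + (i * i + 4) ≡ (p + p + i) * (p + p + i) + 4
  complete-square = solve-∀

4+n+48m<8nm : ∀ n m → 16 * m ≤ n → 1 ≤ m → 4 + n + 48 * m < 8 * (n * m)
4+n+48m<8nm n m 16m≤n 1≤m = begin-strict
  4 + n + 48 * m       <⟨ +-monoˡ-< (48 * m) (+-monoˡ-< n 4<64m) ⟩
  64 * m + n + 48 * m  ≡⟨ regroup m n ⟩
  n + 7 * (16 * m)     ≤⟨ +-monoʳ-≤ n (*-monoʳ-≤ 7 (≤-trans 16m≤n (m≤m*n n m))) ⟩
  n + 7 * (n * m)      ≤⟨ +-monoˡ-≤ (7 * (n * m)) (m≤m*n n m) ⟩
  n * m + 7 * (n * m)  ≡⟨ collect n m ⟩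
  8 * (n * m)          ∎
  where
  open ≤-Reasoning
  4<64m : 4 < 64 * m
  4<64m = ≤-trans (s≤s (s≤s (s≤s (s≤s (s≤s z≤n))))) (*-monoʳ-≤ 64 1≤m)
  regroup : ∀ m n → 64 * m + n + 48 * m ≡ n + 7 * (16 * m)
  regroup = solve-∀
  collect : ∀ n m → n * m + 7 * (n * m) ≡ 8 * (n * m)
  collect = solve-∀
  instance
    m≢0 : NonZero m
    m≢0 = >-nonZero 1≤m

degree-gap : ∀ n m → 16 * m ≤ n → 1 ≤ m → n * n + 4 + 40 * (n * m) < (n + 48 * m) * (n ∸ 1)
degree-gap zero m 16m≤0 1≤m with ≤-trans (*-monoʳ-≤ 16 1≤m) 16m≤0
... | ()
degree-gap n@(suc P) m 16m≤n 1≤m = +-cancelʳ-< (n + 48 * m) _ _ (begin-strict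
  n * n + 4 + 40 * (n * m) + (n + 48 * m)  ≡⟨ regroup n m ⟩
  n * n + 40 * (n * m) + (4 + n + 48 * m)  <⟨ +-monoʳ-< (n * n + 40 * (n * m)) (4+n+48m<8nm n m 16m≤n 1≤m) ⟩
  n * n + 40 * (n * m) + 8 * (n * m)       ≡⟨ factor P m ⟩
  (n + 48 * m) * P + (n + 48 * m)          ∎)
  where
  open ≤-Reasoning
  regroup : ∀ n m → n * n + 4 + 40 * (n * m) + (n + 48 * m) ≡ n * n + 40 * (n * m) + (4 + n + 48 * m)
  regroup = solve-∀
  factor : ∀ P m → suc P * suc P + 40 * (suc P * m) + 8 * (suc P * m) ≡ (suc P + 48 * m) * P + (suc P + 48 * m)
  factor = solve-∀

sparse-link-contradicts-density : ∀ {n m d f T p i} → T ≤ p * (p + i) + i → p + p + i ≤ n →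
  d + d ≤ T + n * f + n * f → f ≤ 5 * m →
  (n + 48 * m) * (n ∸ 1) ≤ 8 * d → 16 * m ≤ n → 1 ≤ m → ⊥
sparse-link-contradicts-density {n} {m} {d} {f} {T} {p} {i} T≤ 2p+i≤n 2d≤ f≤5m dense 16m≤n 1≤m =
  <-irrefl refl (<-≤-trans (degree-gap n m 16m≤n 1≤m) (≤-trans dense 8d≤))
  where
  open ≤-Reasoning
  8d≤ : 8 * d ≤ n * n + 4 + 40 * (n * m)
  8d≤ = begin
    8 * d
      ≡⟨ 8d≡4[d+d] d ⟩
    4 * (d + d)
      ≤⟨ *-monoʳ-≤ 4 2d≤ ⟩
    4 * (T + n * f + n * f)
      ≡⟨ expand T n f ⟩
    4 * T + 8 * (n * f)
      ≤⟨ +-mono-≤ (*-monoʳ-≤ 4 T≤) (*-monoʳ-≤ 8 (*-monoʳ-≤ n f≤5m)) ⟩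
    4 * (p * (p + i) + i) + 8 * (n * (5 * m))
      ≤⟨ +-monoˡ-≤ (8 * (n * (5 * m))) (4[p[p+i]+i]≤[2p+i]²+4 p i) ⟩
    (p + p + i) * (p + p + i) + 4 + 8 * (n * (5 * m))
      ≤⟨ +-monoˡ-≤ (8 * (n * (5 * m))) (+-monoˡ-≤ 4 (*-mono-≤ 2p+i≤n 2p+i≤n)) ⟩
    n * n + 4 + 8 * (n * (5 * m))
      ≡⟨ collect n m ⟩
    n * n + 4 + 40 * (n * m) ∎
    where
    expand : ∀ T n f → 4 * (T + n * f + n * f) ≡ 4 * T + 8 * (n * f)
    expand = solve-∀
    collect : ∀ n m → n * n + 4 + 8 * (n * (5 * m)) ≡ n * n + 4 + 40 * (n * m)
    collect = solve-∀

degree-bounds⇒16m≤n : ∀ n m d → (n + 48 * m) * (n ∸ 1) ≤ 8 * d → d + d ≤ n * (n ∸ 1) → 2 ≤ n →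
                      16 * m ≤ n
degree-bounds⇒16m≤n 1 m d dense sparse (s≤s ())
degree-bounds⇒16m≤n n@(suc P@(suc _)) m d dense sparse _ = *-cancelˡ-≤ 3 (+-cancelˡ-≤ n _ _ (begin
  n + 3 * (16 * m)  ≡⟨ cong (_+_ n) (*-assoc 3 16 m) ⟨
  n + 48 * m        ≤⟨ *-cancelʳ-≤ (n + 48 * m) (4 * n) P (begin
    (n + 48 * m) * P  ≤⟨ dense ⟩
    8 * d             ≡⟨ 8d≡4[d+d] d ⟩
    4 * (d + d)       ≤⟨ *-monoʳ-≤ 4 sparse ⟩
    4 * (n * P)       ≡⟨ *-assoc 4 n P ⟨
    4 * n * P         ∎) ⟩
  4 * n             ≡⟨⟩
  n + 3 * n         ∎))
  where open ≤-Reasoning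

-- Connecting one pair

module Connecting {n : ℕ} (H : Hypergraph3 n) {m : ℕ}
  (dense : ∀ v → (n + 48 * m) * (n ∸ 1) ≤ 8 * degree H v) (16m≤n : 16 * m ≤ n) (1≤m : 1 ≤ m) where

  open import Data.List.Membership.DecPropositional (_≟_ {n}) using (_∈?_)

  record Connector (F : List (Fin n)) (a b : Fin n) : Set where
    field
      x y z : Fin n
      x∉F   : x ∉ F
      y∉F   : y ∉ F
      z∉F   : z ∉ F
      x≢z   : x ≢ z
      axy   : edge H a x y ≡ true
      yzb   : edge H y z b ≡ true

  module _ (F : List (Fin n)) (a b : Fin n) where

    forbidden : Fin n → Bool
    forbidden v = does (v ∈? F)

    link : Fin n → Fin n → Fin n → Bool
    link c = avoiding forbidden (edge H c)

    link-sym : ∀ c x y → link c x y ≡ link c y x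
    link-sym c x y = cong₂ _∧_ (∧-comm (not (forbidden x)) _) (sym₂₃ H c x y)

    link-elim : ∀ {c y x} → link c y x ≡ true → y ∉ F × x ∉ F × edge H c y x ≡ true
    link-elim {c} {y} {x} eq with y ∈? F | x ∈? F | edge H c y x
    link-elim refl | no y∉F | no x∉F | true = y∉F , x∉F , refl

    connector : ∀ {x y z} → link a y x ≡ true → link b y z ≡ true → x ≢ z → Connector F a b
    connector {x} {y} {z} ayx byz x≢z with link-elim ayx | link-elim byz
    ... | y∉F , x∉F , eayx | _ , z∉F , ebyz = record
      { x = x ; y = y ; z = z ; x∉F = x∉F ; y∉F = y∉F ; z∉F = z∉F ; x≢z = x≢z
      ; axy = trans (sym₂₃ H a x y) eayx
      ; yzb = trans (sym (trans (sym₁₂ H b y z) (sym₂₃ H y b z))) ebyz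
      }

    Good : Fin n → Set
    Good y = 1 ≤ count (link a y) × 1 ≤ count (link b y) × (2 ≤ count (link a y) ⊎ 2 ≤ count (link b y))

    good? : ∀ y → Dec (Good y)
    good? y = (1 ≤? _) ×-dec (1 ≤? _) ×-dec ((2 ≤? _) ⊎-dec (2 ≤? _))

    connector-at-good : ∀ {y} → Good y → Connector F a b
    connector-at-good {y} (1≤a , 1≤b , inj₁ 2≤a)
      with z , byz ← count>0⇒∃ (link b y) 1≤b
      with x , x≢z , ayx ← count≥2⇒∃≢ (link a y) 2≤a z
      = connector ayx byz x≢z
    connector-at-good {y} (1≤a , 1≤b , inj₂ 2≤b)
      with x , ayx ← count>0⇒∃ (link a y) 1≤a
      with z , z≢x , byz ← count≥2⇒∃≢ (link b y) 2≤b x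
      = connector ayx byz (z≢x ∘ sym)

    ¬Good⇒a-sparse : ∀ {y} → ¬ Good y → 0 < count (link b y) → count (link a y) ≤ 1
    ¬Good⇒a-sparse {y} ¬good 1≤b with 2 ≤? count (link a y)
    ... | yes 2≤a = ⊥-elim (¬good (≤-trans (s≤s z≤n) 2≤a , 1≤b , inj₁ 2≤a))
    ... | no  2≰a = ≤-pred (≰⇒> 2≰a)

    ¬Good⇒b-sparse : ∀ {y} → ¬ Good y → 0 < count (link a y) → count (link b y) ≤ 1
    ¬Good⇒b-sparse {y} ¬good 1≤a with 2 ≤? count (link b y)
    ... | yes 2≤b = ⊥-elim (¬good (1≤a , ≤-trans (s≤s z≤n) 2≤b , inj₂ 2≤b))
    ... | no  2≰b = ≤-pred (≰⇒> 2≰b)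

    module La = SymmetricRelation (link a) (link-sym a)
    module Lb = SymmetricRelation (link b) (link-sym b)

    sparse-link⇒⊥ : length F ≤ 5 * m →
                    ∀ c s i → #pairs (link c) ≤ s * (s + i) + i → s + s + i ≤ n → ⊥
    sparse-link⇒⊥ F-small c s i pairs≤ 2s+i≤n =
      sparse-link-contradicts-density {d = degree H c} {p = s} {i = i} pairs≤ 2s+i≤n degree≤
        (≤-trans (count-∈ F) F-small) (dense c) 16m≤n 1≤m
      where
      degree≤ : degree H c + degree H c ≤ #pairs (link c) + n * count forbidden + n * count forbidden
      degree≤ = subst (_≤ #pairs (link c) + n * count forbidden + n * count forbidden)
        (sym (degree-doubled H c)) (#pairs-avoiding forbidden (edge H c))

    no-good⇒⊥ : length F ≤ 5 * m → (∀ y → ¬ Good y) → ⊥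
    no-good⇒⊥ F-small no-good = [ p≤q⇒⊥ , q≤p⇒⊥ ]′ (≤-total p q)
      where
      A B : Fin n → Bool
      A = La.nonIsolated
      B = Lb.nonIsolated
      p q i : ℕ
      p = count (λ y → A y ∧ not (B y))
      q = count (λ y → B y ∧ not (A y))
      i = count (λ y → A y ∧ B y)
      pairs-a : #pairs (link a) ≤ p * (p + i) + i
      pairs-a = subst (λ k → #pairs (link a) ≤ p * k + i) (count-split A B)
        (La.#pairs-bound B (λ y By → ¬Good⇒a-sparse (no-good y) (Lb.nonIsolated⇒count>0 By)))
      pairs-b : #pairs (link b) ≤ q * (q + i) + i
      pairs-b = subst (λ k → #pairs (link b) ≤ q * (q + k) + k) (count-cong (λ y → ∧-comm (B y) (A y)))
        (subst (λ k → #pairs (link b) ≤ q * k + count (λ y → B y ∧ A y)) (count-split B A)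
          (Lb.#pairs-bound A (λ y Ay → ¬Good⇒b-sparse (no-good y) (La.nonIsolated⇒count>0 Ay))))
      p+i+q≤n : p + i + q ≤ n
      p+i+q≤n = subst (λ k → k + q ≤ n) (count-split A B) (count-disjoint disjoint)
        where
        disjoint : ∀ y → A y ∧ (B y ∧ not (A y)) ≡ false
        disjoint y with A y
        ... | false = refl
        ... | true  = ∧-zeroʳ (B y)
      s+s+i≡s+i+s : ∀ s → s + s + i ≡ s + i + s
      s+s+i≡s+i+s s = trans (+-assoc s s i) (+-comm s (s + i))
      p≤q⇒⊥ : p ≤ q → ⊥
      p≤q⇒⊥ p≤q = sparse-link⇒⊥ F-small a p i pairs-a
        (≤-trans (≤-reflexive (s+s+i≡s+i+s p)) (≤-trans (+-monoʳ-≤ (p + i) p≤q) p+i+q≤n))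
      q≤p⇒⊥ : q ≤ p → ⊥
      q≤p⇒⊥ q≤p = sparse-link⇒⊥ F-small b q i pairs-b
        (≤-trans (≤-reflexive (s+s+i≡s+i+s q)) (≤-trans (+-monoˡ-≤ q (+-monoˡ-≤ i q≤p)) p+i+q≤n))

    connect : length F ≤ 5 * m → Connector F a b
    connect F-small with any? good?
    ... | yes (y , good) = connector-at-good good
    ... | no  no-good    = ⊥-elim (no-good⇒⊥ F-small (λ y good → no-good (y , good)))

module _ {A : Set} where

  Unique-insert : ∀ xs {ys zs : List A} → Unique (xs ++ ys) → Unique zs → All (_∉ xs ++ ys) zs →
                  Unique (xs ++ zs ++ ys)
  Unique-insert xs {ys} {zs} unique-xsys unique-zs fresh =
    Permutationₛ.Unique-resp-↭ (setoid A) (↭⇒↭ₛ (shifts zs xs))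
      (Unique.++⁺ unique-zs unique-xsys (λ (v∈zs , v∈xsys) → All.lookup fresh v∈zs v∈xsys))

  concatMap-allFin-suc : ∀ {k} (g : Fin (suc k) → List A) →
    concatMap g (allFin (suc k)) ≡ g zero ++ concatMap (g ∘ suc) (allFin k)
  concatMap-allFin-suc g = cong (λ gs → g zero ++ concat gs)
    (trans (map-tabulate suc g) (sym (map-tabulate (λ i → i) (g ∘ suc))))

module _ {n k : ℕ} where

  pairVertices-suc : (a b : Fin (suc k) → Fin n) →
    pairVertices a b ≡ a zero ∷ b zero ∷ pairVertices (a ∘ suc) (b ∘ suc)
  pairVertices-suc a b = concatMap-allFin-suc (λ i → a i ∷ b i ∷ [])

  allVertices-suc : (a b x y z : Fin (suc k) → Fin n) →
    allVertices a b x y z ≡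
      a zero ∷ b zero ∷ x zero ∷ y zero ∷ z zero ∷
      allVertices (a ∘ suc) (b ∘ suc) (x ∘ suc) (y ∘ suc) (z ∘ suc)
  allVertices-suc a b x y z = concatMap-allFin-suc (λ i → a i ∷ b i ∷ x i ∷ y i ∷ z i ∷ [])

length-pairVertices : ∀ {n k} (a b : Fin k → Fin n) → length (pairVertices a b) ≡ k + k
length-pairVertices {k = zero}  a b = refl
length-pairVertices {k = suc k} a b = begin
  length (pairVertices a b)                      ≡⟨ cong length (pairVertices-suc a b) ⟩
  2 + length (pairVertices (a ∘ suc) (b ∘ suc))  ≡⟨ cong (_+_ 2) (length-pairVertices (a ∘ suc) (b ∘ suc)) ⟩
  2 + (k + k)                                    ≡⟨ cong suc (+-suc k k) ⟨
  suc k + suc k                                  ∎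
  where open ≡-Reasoning

-- Connecting all pairs

module _ {n : ℕ} (H : Hypergraph3 n) {m : ℕ}
  (dense : ∀ v → (n + 48 * m) * (n ∸ 1) ≤ 8 * degree H v) (16m≤n : 16 * m ≤ n) (1≤m : 1 ≤ m) where

  open Connecting H dense 16m≤n 1≤m using (Connector; connect)

  connect-all : ∀ k (a b : Fin k → Fin n) (E : List (Fin n)) →
    Unique (E ++ pairVertices a b) → length E + 5 * k ≤ 5 * m →
    Σ (Fin k → Fin n) λ x → Σ (Fin k → Fin n) λ y → Σ (Fin k → Fin n) λ z →
      Unique (E ++ allVertices a b x y z) ×
      (∀ i → (edge H (a i) (x i) (y i) ≡ true) × (edge H (y i) (z i) (b i) ≡ true))
  connect-all zero    a b E unique budget = (λ ()) , (λ ()) , (λ ()) , unique , λ ()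
  connect-all (suc k) a b E unique budget =
    let (x′ , y′ , z′ , unique-rest , edges-rest) = connect-all k (a ∘ suc) (b ∘ suc) E′ unique-E′ budget′
    in  x Vector.∷ x′ , y Vector.∷ y′ , z Vector.∷ z′
      , subst Unique (trans (++-assoc E (a₀ ∷ b₀ ∷ x ∷ y ∷ z ∷ []) _)
          (sym (cong (E ++_) (allVertices-suc a b (x Vector.∷ x′) (y Vector.∷ y′) (z Vector.∷ z′))))) unique-rest
      , λ { zero → axy , yzb ; (suc i) → edges-rest i }
    where
    a₀ b₀ : Fin n
    a₀ = a zero
    b₀ = b zero
    P′ F : List (Fin n)
    P′ = pairVertices (a ∘ suc) (b ∘ suc)
    F = E ++ a₀ ∷ b₀ ∷ P′
    F-small : length F ≤ 5 * m
    F-small = begin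
      length F
        ≡⟨ length-++ E ⟩
      length E + (2 + length P′)
        ≡⟨ cong (λ l → length E + (2 + l)) (length-pairVertices (a ∘ suc) (b ∘ suc)) ⟩
      length E + (2 + (k + k))
        ≤⟨ +-monoʳ-≤ (length E) (+-mono-≤ (m≤m+n 2 3) (k+k≤5k k)) ⟩
      length E + (5 + 5 * k)
        ≡⟨ cong (_+_ (length E)) (*-suc 5 k) ⟨
      length E + 5 * suc k
        ≤⟨ budget ⟩
      5 * m ∎
      where open ≤-Reasoning
    open Connector (connect F a₀ b₀ F-small)
    E′ : List (Fin n)
    E′ = E ++ a₀ ∷ b₀ ∷ x ∷ y ∷ z ∷ []
    E₂ : List (Fin n)
    E₂ = E ++ a₀ ∷ b₀ ∷ []
    F≡E₂++P′ : F ≡ E₂ ++ P′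
    F≡E₂++P′ = sym (++-assoc E (a₀ ∷ b₀ ∷ []) P′)
    unique-F : Unique F
    unique-F = subst (Unique ∘ (E ++_)) (pairVertices-suc a b) unique
    unique-xyz : Unique (x ∷ y ∷ z ∷ [])
    unique-xyz = (edge⇒≢₂₃ H axy ∷ x≢z ∷ []) ∷ (edge⇒≢₁₂ H yzb ∷ []) ∷ [] ∷ []
    E₂++xyz++P′≡E′++P′ : E₂ ++ (x ∷ y ∷ z ∷ []) ++ P′ ≡ E′ ++ P′
    E₂++xyz++P′≡E′++P′ =
      trans (++-assoc E (a₀ ∷ b₀ ∷ []) _) (sym (++-assoc E (a₀ ∷ b₀ ∷ x ∷ y ∷ z ∷ []) P′))
    unique-E′ : Unique (E′ ++ P′)
    unique-E′ = subst Unique E₂++xyz++P′≡E′++P′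
      (Unique-insert E₂ (subst Unique F≡E₂++P′ unique-F) unique-xyz
        (subst (λ l → All (_∉ l) (x ∷ y ∷ z ∷ [])) F≡E₂++P′ (x∉F ∷ y∉F ∷ z∉F ∷ [])))
    budget′ : length E′ + 5 * k ≤ 5 * m
    budget′ = begin
      length E′ + 5 * k       ≡⟨ cong (_+ 5 * k) (length-++ E) ⟩
      length E + 5 + 5 * k    ≡⟨ +-assoc (length E) 5 (5 * k) ⟩
      length E + (5 + 5 * k)  ≡⟨ cong (_+_ (length E)) (*-suc 5 k) ⟨
      length E + 5 * suc k    ≤⟨ budget ⟩
      5 * m                   ∎
      where open ≤-Reasoning

-- Clearing denominators

dense-from-ℤ : ∀ (g D : ℤ) .{{_ : ℤ.Positive D}} (m P C d : ℕ) → 2 * C ≡ suc P * P →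
  (D ℤ.+ g ℤ.* + 4) ℤ.* + C ℤ.≤ + d ℤ.* (+ 4 ℤ.* D) →
  + m ℤ.* (D ℤ.* + 12) ℤ.≤ g ℤ.* + suc P →
  (suc P + 48 * m) * P ≤ 8 * d
dense-from-ℤ g D m P C d 2C≡nP min-degree budget = ℤ.drop‿+≤+ (subst₂ ℤ._≤_ (sym lhs) (sym rhs)
  (ℤ.*-cancelˡ-≤-pos _ _ D (begin
    D ℤ.* ((N ℤ.+ + 48 ℤ.* + m) ℤ.* + P)
      ≡⟨ expand D N (+ m) (+ P) ⟩
    D ℤ.* N ℤ.* + P ℤ.+ + 4 ℤ.* (+ m ℤ.* (D ℤ.* + 12)) ℤ.* + P
      ≤⟨ ℤ.+-monoʳ-≤ (D ℤ.* N ℤ.* + P) (ℤ.*-monoʳ-≤-nonNeg (+ P) (ℤ.*-monoˡ-≤-nonNeg (+ 4) budget)) ⟩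
    D ℤ.* N ℤ.* + P ℤ.+ + 4 ℤ.* (g ℤ.* N) ℤ.* + P
      ≡⟨ factor D g N (+ P) ⟩
    (D ℤ.+ g ℤ.* + 4) ℤ.* (N ℤ.* + P)
      ≡⟨ cong ((D ℤ.+ g ℤ.* + 4) ℤ.*_) NP≡2C ⟩
    (D ℤ.+ g ℤ.* + 4) ℤ.* (+ 2 ℤ.* + C)
      ≡⟨ reassociate D g (+ C) ⟩
    + 2 ℤ.* ((D ℤ.+ g ℤ.* + 4) ℤ.* + C)
      ≤⟨ ℤ.*-monoˡ-≤-nonNeg (+ 2) min-degree ⟩
    + 2 ℤ.* (+ d ℤ.* (+ 4 ℤ.* D))
      ≡⟨ collect D (+ d) ⟩
    D ℤ.* (+ 8 ℤ.* + d) ∎)))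
  where
  open ℤ.≤-Reasoning
  N : ℤ
  N = + suc P
  lhs : + ((suc P + 48 * m) * P) ≡ (N ℤ.+ + 48 ℤ.* + m) ℤ.* + P
  lhs = trans (ℤ.pos-* (suc P + 48 * m) P)
          (cong (ℤ._* + P) (trans (ℤ.pos-+ (suc P) (48 * m)) (cong (λ t → N ℤ.+ t) (ℤ.pos-* 48 m))))
  rhs : + (8 * d) ≡ + 8 ℤ.* + d
  rhs = ℤ.pos-* 8 d
  NP≡2C : N ℤ.* + P ≡ + 2 ℤ.* + C
  NP≡2C = trans (sym (ℤ.pos-* (suc P) P)) (trans (cong +_ (sym 2C≡nP)) (ℤ.pos-* 2 C))
  expand : ∀ D N m P →
    D ℤ.* ((N ℤ.+ + 48 ℤ.* m) ℤ.* P) ≡ D ℤ.* N ℤ.* P ℤ.+ + 4 ℤ.* (m ℤ.* (D ℤ.* + 12)) ℤ.* P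
  expand = ℤ-Solver.solve-∀
  factor : ∀ D g N P → D ℤ.* N ℤ.* P ℤ.+ + 4 ℤ.* (g ℤ.* N) ℤ.* P ≡ (D ℤ.+ g ℤ.* + 4) ℤ.* (N ℤ.* P)
  factor = ℤ-Solver.solve-∀
  reassociate : ∀ D g C → (D ℤ.+ g ℤ.* + 4) ℤ.* (+ 2 ℤ.* C) ≡ + 2 ℤ.* ((D ℤ.+ g ℤ.* + 4) ℤ.* C)
  reassociate = ℤ-Solver.solve-∀
  collect : ∀ D d → + 2 ℤ.* (d ℤ.* (+ 4 ℤ.* D)) ≡ D ℤ.* (+ 8 ℤ.* d)
  collect = ℤ-Solver.solve-∀

min-degree⇒ℤ : ∀ γ C d → (+ 1 / 4 ℚ.+ γ) ℚ.* (+ C / 1) ℚ.≤ + d / 1 →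
  (ℚ.↧ γ ℤ.+ ℚ.↥ γ ℤ.* + 4) ℤ.* + C ℤ.≤ + d ℤ.* (+ 4 ℤ.* ℚ.↧ γ)
min-degree⇒ℤ γ@(mkℚ g e _) C d hyp = subst₂ ℤ._≤_ (clear-lhs (+ suc e) g (+ C)) (clear-rhs (+ suc e) (+ d))
  (ℚᵘ.drop-*≤* (ℚᵘ.≤-respˡ-≃ lhs (ℚᵘ.≤-respʳ-≃ rhs (ℚ.toℚᵘ-mono-≤ hyp))))
  where
  lhs : toℚᵘ ((+ 1 / 4 ℚ.+ γ) ℚ.* (+ C / 1)) ℚᵘ.≃
        (ℚᵘ.mkℚᵘ (+ 1) 3 ℚᵘ.+ ℚᵘ.mkℚᵘ g e) ℚᵘ.* ℚᵘ.mkℚᵘ (+ C) 0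
  lhs = ℚᵘ.≃-trans (ℚ.toℚᵘ-homo-* (+ 1 / 4 ℚ.+ γ) (+ C / 1))
    (ℚᵘ.*-cong
      (ℚᵘ.≃-trans (ℚ.toℚᵘ-homo-+ (+ 1 / 4) γ)
                  (ℚᵘ.+-cong (ℚ.toℚᵘ-fromℚᵘ (ℚᵘ.mkℚᵘ (+ 1) 3)) (ℚᵘ.≃-refl {ℚᵘ.mkℚᵘ g e})))
      (ℚ.toℚᵘ-fromℚᵘ (ℚᵘ.mkℚᵘ (+ C) 0)))
  rhs : toℚᵘ (+ d / 1) ℚᵘ.≃ ℚᵘ.mkℚᵘ (+ d) 0
  rhs = ℚ.toℚᵘ-fromℚᵘ (ℚᵘ.mkℚᵘ (+ d) 0)
  clear-lhs : ∀ D g C → ((+ 1 ℤ.* D ℤ.+ g ℤ.* + 4) ℤ.* C) ℤ.* + 1 ≡ (D ℤ.+ g ℤ.* + 4) ℤ.* C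
  clear-lhs = ℤ-Solver.solve-∀
  clear-rhs : ∀ D d → d ℤ.* ((+ 4 ℤ.* D) ℤ.* + 1) ≡ d ℤ.* (+ 4 ℤ.* D)
  clear-rhs = ℤ-Solver.solve-∀

budget⇒ℤ : ∀ γ m n → + m / 1 ℚ.≤ γ ℚ.* (+ n / 12) →
           + m ℤ.* (ℚ.↧ γ ℤ.* + 12) ℤ.≤ ℚ.↥ γ ℤ.* + n
budget⇒ℤ γ@(mkℚ g e _) m n hyp = subst (_ ℤ.≤_) (ℤ.*-identityʳ (g ℤ.* + n))
  (ℚᵘ.drop-*≤* (ℚᵘ.≤-respˡ-≃ lhs (ℚᵘ.≤-respʳ-≃ rhs (ℚ.toℚᵘ-mono-≤ hyp))))
  where
  lhs : toℚᵘ (+ m / 1) ℚᵘ.≃ ℚᵘ.mkℚᵘ (+ m) 0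
  lhs = ℚ.toℚᵘ-fromℚᵘ (ℚᵘ.mkℚᵘ (+ m) 0)
  rhs : toℚᵘ (γ ℚ.* (+ n / 12)) ℚᵘ.≃ ℚᵘ.mkℚᵘ g e ℚᵘ.* ℚᵘ.mkℚᵘ (+ n) 11
  rhs = ℚᵘ.≃-trans (ℚ.toℚᵘ-homo-* γ (+ n / 12))
          (ℚᵘ.*-cong (ℚᵘ.≃-refl {ℚᵘ.mkℚᵘ g e}) (ℚ.toℚᵘ-fromℚᵘ (ℚᵘ.mkℚᵘ (+ n) 11)))

2*[1+n]C2≡[1+n]*n : ∀ n → 2 * (suc n C 2) ≡ suc n * n
2*[1+n]C2≡[1+n]*n zero    = refl
2*[1+n]C2≡[1+n]*n (suc n) = begin
  2 * (suc (suc n) C 2)        ≡⟨ cong (2 *_) (nCk+nC[k+1]≡[n+1]C[k+1] (suc n) 1) ⟨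
  2 * (suc n C 1 + suc n C 2)  ≡⟨ cong (λ t → 2 * (t + suc n C 2)) (nC1≡n (suc n)) ⟩
  2 * (suc n + suc n C 2)      ≡⟨ *-distribˡ-+ 2 (suc n) _ ⟩
  2 * suc n + 2 * (suc n C 2)  ≡⟨ cong (λ t → 2 * suc n + t) (2*[1+n]C2≡[1+n]*n n) ⟩
  2 * suc n + suc n * n        ≡⟨ collect n ⟩
  suc (suc n) * suc n          ∎
  where
  open ≡-Reasoning
  collect : ∀ n → 2 * suc n + suc n * n ≡ suc (suc n) * suc n
  collect = solve-∀

dense-from-ℚ : ∀ γ m n d →
  (+ 1 / 4 ℚ.+ γ) ℚ.* (+ (n C 2) / 1) ℚ.≤ + d / 1 → + m / 1 ℚ.≤ γ ℚ.* (+ n / 12) →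
  (n + 48 * m) * (n ∸ 1) ≤ 8 * d
dense-from-ℚ γ             m zero    d _          _      = ≤-trans (≤-reflexive (*-zeroʳ (48 * m))) z≤n
dense-from-ℚ γ@(mkℚ _ _ _) m (suc P) d min-degree budget =
  dense-from-ℤ (ℚ.↥ γ) (ℚ.↧ γ) m P (suc P C 2) d (2*[1+n]C2≡[1+n]*n P)
    (min-degree⇒ℤ γ (suc P C 2) d min-degree) (budget⇒ℤ γ m (suc P) budget)

two-distinct⇒2≤n : ∀ {n} {x y : Fin n} → x ≢ y → 2 ≤ n
two-distinct⇒2≤n {suc zero}    {zero} {zero} x≢y = ⊥-elim (x≢y refl)
two-distinct⇒2≤n {suc (suc _)}                _   = s≤s (s≤s z≤n)

lemma2p1 : (γ : ℚ) → ℚ.0ℚ ℚ.< γ → (m : ℕ) → m ≥ 1 → (n : ℕ) → (H : Hypergraph3 n) →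
    (∀ (v : Fin n) → (+ 1 / 4 ℚ.+ γ) ℚ.* (+ (n C 2) / 1) ℚ.≤ + (degree H v) / 1) →
    + m / 1 ℚ.≤ γ ℚ.* (+ n / 12) →
    (a b : Fin m → Fin n) → Unique (pairVertices a b) →
    Σ (Fin m → Fin n) λ x → Σ (Fin m → Fin n) λ y → Σ (Fin m → Fin n) λ z →
      Connects H a b x y z
lemma2p1 γ _ m@(suc _) m≥1 n H min-degree budget a b unique =
  connect-all H dense 16m≤n m≥1 m a b [] unique ≤-refl
  where
  dense : ∀ v → (n + 48 * m) * (n ∸ 1) ≤ 8 * degree H v
  dense v = dense-from-ℚ γ m n (degree H v) (min-degree v) budget
  a₀≢b₀ : a zero ≢ b zero
  a₀≢b₀ with subst Unique (pairVertices-suc a b) unique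
  ... | (a₀≢b₀ ∷ _) ∷ _ = a₀≢b₀
  16m≤n : 16 * m ≤ n
  16m≤n = degree-bounds⇒16m≤n n m (degree H (a zero)) (dense (a zero)) (degree-upper H (a zero))
                              (two-distinct⇒2≤n a₀≢b₀)
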